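{- Let $\Gamma=\mathrm{WH}_n(a,b,c,d)$ be a vertex-transitive Woolly Hat graph such that $n$ is even, $b,d\neq 0$, $2a=d-b$, the $2$-part of $\gcd(c,n)$ exceeds that of $\gcd(a,n)$, and the two $\mathrm{Aut}(\Gamma)$-orbits on edges are the set of blue edges and the set of red edges (as defined in the context). Then: if $4a\neq 0$, each red $2$-path of $\Gamma$ lies on exactly two basic $6$-cycles; if $4a=0$, each red $2$-path lies on exactly four basic $6$-cycles.
   Context: For an integer $n\ge 3$ and $a,b,c,d\in\mathbb{Z}_n$ with $2a\neq 0$, $b,c,d$ pairwise distinct, and such that no prime divides $n$ together with (integer representatives of) all of $a,b,c,d$, the Woolly Hat graph $\mathrm{WH}_n(a,b,c,d)$ is the graph with vertex set $\{A_i,B_i,C_i : i\in\mathbb{Z}_n\}$ with adjacencies, for each $i\in\mathbb{Z}_n$ (subscripts mod $n$): $A_i\sim A_{i-a},A_{i+a},B_i,C_i$; $B_i\sim A_i,C_{i+b},C_{i+c},C_{i+d}$; $C_i\sim A_i,B_{i-b},B_{i-c},B_{i-d}$. Blue edges: the edges $A_iB_i$, $A_iC_i$, $B_iC_{i+c}$; red edges: $A_iA_{i+a}$, $B_iC_{i+b}$, $B_iC_{i+d}$ ($i\in\mathbb{Z}_n$). A red $2$-path is a path of length $2$ with both edges red. A basic $6$-cycle is a $6$-cycle with exactly four red and two blue edges, the two blue edges being antipodal on the cycle. The $2$-part of a positive integer $m$ is the largest power of $2$ dividing $m$. -}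

module Defs where

open import Data.Nat using (ℕ; zero; suc; _+_; _*_; _∸_; _^_; _<_; _≤_)
open import Data.Nat.DivMod using (_mod_)
open import Data.Nat.Divisibility using (_∣_)
open import Data.Nat.GCD using (gcd)
open import Data.Nat.Primality using (Prime)
open import Data.Fin using (Fin; toℕ)
open import Data.Product using (Σ; ∃; _×_; _,_)
open import Data.Sum using (_⊎_)
open import Data.Empty using (⊥)
open import Data.List using (List; length)
open import Data.List.Relation.Unary.All using (All)
open import Data.List.Relation.Unary.Unique.Propositional using (Unique)
open import Data.List.Membership.Propositional using (_∈_)
open import Relation.Nullary using (¬_)
open import Relation.Binary.PropositionalEquality using (_≡_; _≢_)

infixl 6 _⊕_ _⊖_

_⊕_ : ∀ {n} → Fin n → Fin n → Fin n
_⊕_ {suc m} i j = (toℕ i + toℕ j) mod (suc m)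

⊖_ : ∀ {n} → Fin n → Fin n
⊖_ {suc m} i = (suc m ∸ toℕ i) mod (suc m)

_⊖_ : ∀ {n} → Fin n → Fin n → Fin n
i ⊖ j = i ⊕ (⊖ j)

_·_ : ∀ {n} → ℕ → Fin n → Fin n
_·_ {suc m} k x = (k * toℕ x) mod (suc m)

IsZero : ∀ {n} → Fin n → Set
IsZero x = toℕ x ≡ 0

TwoPart : ℕ → ℕ → Set
TwoPart m q = (∃ λ e → q ≡ 2 ^ e) × (q ∣ m) × ¬ ((2 * q) ∣ m)

HasExactly : ∀ {T : Set} → ℕ → (T → Set) → Set
HasExactly {T} k P =
  Σ (List T) λ xs → (length xs ≡ k) × Unique xs × All P xs × (∀ t → P t → t ∈ xs)

data V (n : ℕ) : Set where
  A B C : Fin n → V n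

WHParams : (n : ℕ) → (a b c d : Fin n) → Set
WHParams n a b c d =
  (3 ≤ n) × ¬ IsZero (2 · a) × (b ≢ c) × (b ≢ d) × (c ≢ d) ×
  (∀ p → Prime p → p ∣ n → p ∣ toℕ a → p ∣ toℕ b → p ∣ toℕ c → p ∣ toℕ d → ⊥)

module WH {n : ℕ} (a b c d : Fin n) where

  data BlueArc : V n → V n → Set where
    ab : ∀ i → BlueArc (A i) (B i)
    ac : ∀ i → BlueArc (A i) (C i)
    bc : ∀ i j → j ≡ i ⊕ c → BlueArc (B i) (C j)

  data RedArc : V n → V n → Set where
    aa  : ∀ i j → j ≡ i ⊕ a → RedArc (A i) (A j)
    bcb : ∀ i j → j ≡ i ⊕ b → RedArc (B i) (C j)
    bcd : ∀ i j → j ≡ i ⊕ d → RedArc (B i) (C j)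

  Blue Red Adj : V n → V n → Set
  Blue u v = BlueArc u v ⊎ BlueArc v u
  Red u v = RedArc u v ⊎ RedArc v u
  Adj u v = Blue u v ⊎ Red u v

  record Aut : Set where
    field
      f g : V n → V n
      f∘g : ∀ v → f (g v) ≡ v
      g∘f : ∀ v → g (f v) ≡ v
      pres : ∀ u v → Adj u v → Adj (f u) (f v)
      refl' : ∀ u v → Adj (f u) (f v) → Adj u v

  open Aut public

  VertexTransitive : Set
  VertexTransitive = ∀ u v → Σ Aut λ φ → f φ u ≡ v

  MapsEdge : Aut → V n → V n → V n → V n → Set
  MapsEdge φ u v u' v' = (f φ u ≡ u' × f φ v ≡ v') ⊎ (f φ u ≡ v' × f φ v ≡ u')

  EdgeOrbitsBlueRed : Set
  EdgeOrbitsBlueRed =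
    (∀ u v u' v' → Blue u v → Blue u' v' → Σ Aut λ φ → MapsEdge φ u v u' v') ×
    (∀ u v u' v' → Red u v → Red u' v' → Σ Aut λ φ → MapsEdge φ u v u' v') ×
    (∀ (φ : Aut) u v → Blue u v → ¬ Red (f φ u) (f φ v)) ×
    (∀ (φ : Aut) u v → Red u v → ¬ Blue (f φ u) (f φ v))

  Red2Path : V n → V n → V n → Set
  Red2Path u v w = (u ≢ v) × (v ≢ w) × (u ≢ w) × Red u v × Red v w

  Distinct6 : V n → V n → V n → V n → V n → V n → Set
  Distinct6 v0 v1 v2 v3 v4 v5 =
    (v0 ≢ v1) × (v0 ≢ v2) × (v0 ≢ v3) × (v0 ≢ v4) × (v0 ≢ v5) ×
    (v1 ≢ v2) × (v1 ≢ v3) × (v1 ≢ v4) × (v1 ≢ v5) ×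
    (v2 ≢ v3) × (v2 ≢ v4) × (v2 ≢ v5) ×
    (v3 ≢ v4) × (v3 ≢ v5) ×
    (v4 ≢ v5)

  -- v0 v1 v2 v3 v4 v5 v0 is a basic 6-cycle: a 6-cycle with four red and
  -- two blue edges, the blue edges antipodal
  Basic6 : V n → V n → V n → V n → V n → V n → Set
  Basic6 v0 v1 v2 v3 v4 v5 =
    Distinct6 v0 v1 v2 v3 v4 v5 ×
    ( (Blue v0 v1 × Red v1 v2 × Red v2 v3 × Blue v3 v4 × Red v4 v5 × Red v5 v0)
    ⊎ (Red v0 v1 × Blue v1 v2 × Red v2 v3 × Red v3 v4 × Blue v4 v5 × Red v5 v0)
    ⊎ (Red v0 v1 × Red v1 v2 × Blue v2 v3 × Red v3 v4 × Red v4 v5 × Blue v5 v0))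

  -- the basic 6-cycles through the 2-path u - v - w, each represented
  -- uniquely by its remaining vertices (x , y , z) read as u v w x y z u
  Basic6Through : V n → V n → V n → V n × V n × V n → Set
  Basic6Through u v w (x , y , z) = Basic6 u v w x y z

-- Up to reversal and the colour-preserving automorphism A_i ↦ A_{-i}, B_i ↦ C_{-i},
-- C_i ↦ B_{-i}, a red 2-path is A_p A_{p+a} A_{p+2a} or C_{q+b} B_q C_{q+d}; either way its
-- end indices differ by 2a = d - b. As the path is red and the blue edges of a basic
-- 6-cycle are antipodal, such a cycle closes the path by a blue edge, a red 2-path and a
-- blue edge, and that red 2-path has to cancel the offset 2a.
-- Traversed in the natural order (b then d, or a twice) this works for exactly two choices
-- of the blue edges; traversed in the opposite order it cancels -2a instead, which is the
-- same offset exactly when 4a = 0, giving two further cycles. The six vertices are then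
-- distinct because 2a ≠ 0 and because a red edge B_s C_t is never blue (b ≠ c ≠ d).
module Submission where

open import Defs
open import Data.Nat using (ℕ; zero; suc; _+_; _*_; _∸_; _<_)
open import Data.Nat.Divisibility using (_∣_)
open import Data.Nat.GCD using (gcd)
open import Data.Nat.Properties using (+-comm; +-assoc; +-identityʳ; *-distribʳ-+; m+[n∸m]≡n)
open import Data.Nat.DivMod using (_mod_; _%_; m%n<n; m%n%n≡m%n; m<n⇒m%n≡m; %-distribˡ-+; n%n≡0)
open import Data.Fin using (Fin; toℕ) renaming (zero to 0F)
open import Data.Fin.Properties using (toℕ-injective; toℕ<n; toℕ-fromℕ<; toℕ≤n)
open import Data.Product using (Σ; _×_; _,_; proj₁; proj₂)
open import Data.Sum using (_⊎_; inj₁; inj₂; swap)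
open import Function using (_∘_)
open import Data.Empty using (⊥-elim)
open import Data.List using ([]; _∷_; map)
open import Data.List.Properties using (length-map)
import Data.List.Relation.Unary.All as All
open import Data.List.Relation.Unary.All using ([]; _∷_)
import Data.List.Relation.Unary.All.Properties as All
open import Data.List.Relation.Unary.AllPairs using ([]; _∷_)
open import Data.List.Relation.Unary.Any using (here; there)
open import Data.List.Relation.Unary.Unique.Propositional using (Unique)
import Data.List.Relation.Unary.Unique.Propositional.Properties as Unique
open import Data.List.Membership.Propositional using (_∈_)
open import Data.List.Membership.Propositional.Properties using (∈-map⁺)
open import Relation.Nullary using (¬_)
open import Level using (0ℓ)
open import Algebra.Bundles using (AbelianGroup)
open import Algebra.Structures using (IsAbelianGroup)
open import Relation.Binary.PropositionalEquality

HasExactly-bijection : ∀ {X Y : Set} {P : X → Set} {Q : Y → Set} {k} (f : X → Y) (g : Y → X) →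
  (∀ x → g (f x) ≡ x) → (∀ y → f (g y) ≡ y) →
  (∀ {x} → P x → Q (f x)) → (∀ {y} → Q y → P (g y)) →
  HasExactly k P → HasExactly k Q
HasExactly-bijection f g g∘f f∘g P⇒Q Q⇒P (xs , |xs|≡k , unique , all , complete) =
  map f xs , trans (length-map f xs) |xs|≡k , Unique.map⁺ f-injective unique ,
  All.map⁺ (All.map P⇒Q all) ,
  λ y qy → subst (_∈ map f xs) (f∘g y) (∈-map⁺ f (complete (g y) (Q⇒P qy)))
  where
  f-injective : ∀ {x x′} → f x ≡ f x′ → x ≡ x′
  f-injective {x} {x′} fx≡fx′ = trans (sym (g∘f x)) (trans (cong g fx≡fx′) (g∘f x′))

AmongTwoOrFour : ∀ {X : Set} → Set → X → X → X → X → X → Set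
AmongTwoOrFour Z x₁ x₂ x₃ x₄ x = x ≡ x₁ ⊎ x ≡ x₂ ⊎ Z × (x ≡ x₃ ⊎ x ≡ x₄)

exactly-two-or-four : ∀ {X : Set} {P : X → Set} {Z : Set} (x₁ x₂ x₃ x₄ : X) →
  Unique (x₁ ∷ x₂ ∷ x₃ ∷ x₄ ∷ []) →
  P x₁ → P x₂ → (Z → P x₃) → (Z → P x₄) →
  (∀ x → P x → AmongTwoOrFour Z x₁ x₂ x₃ x₄ x) →
  (¬ Z → HasExactly 2 P) × (Z → HasExactly 4 P)
exactly-two-or-four {Z = Z} x₁ x₂ x₃ x₄ unique@((x₁≢x₂ ∷ _) ∷ _) p₁ p₂ p₃ p₄ classify =
  (λ ¬z → x₁ ∷ x₂ ∷ [] , refl , (x₁≢x₂ ∷ []) ∷ [] ∷ [] , p₁ ∷ p₂ ∷ [] ,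
          λ x px → two ¬z (classify x px)) ,
  (λ z → x₁ ∷ x₂ ∷ x₃ ∷ x₄ ∷ [] , refl , unique , p₁ ∷ p₂ ∷ p₃ z ∷ p₄ z ∷ [] ,
         λ x px → four (classify x px))
  where
  two : ∀ {x} → ¬ Z → AmongTwoOrFour Z x₁ x₂ x₃ x₄ x → x ∈ x₁ ∷ x₂ ∷ []
  two _  (inj₁ refl)             = here refl
  two _  (inj₂ (inj₁ refl))      = there (here refl)
  two ¬z (inj₂ (inj₂ (z , _)))   = ⊥-elim (¬z z)
  four : ∀ {x} → AmongTwoOrFour Z x₁ x₂ x₃ x₄ x → x ∈ x₁ ∷ x₂ ∷ x₃ ∷ x₄ ∷ []
  four (inj₁ refl)                   = here refl
  four (inj₂ (inj₁ refl))            = there (here refl)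
  four (inj₂ (inj₂ (_ , inj₁ refl))) = there (there (here refl))
  four (inj₂ (inj₂ (_ , inj₂ refl))) = there (there (there (here refl)))

module CyclicGroup (m : ℕ) where
  open ≡-Reasoning

  private
    N : ℕ
    N = suc m

  toℕ-mod : ∀ k → toℕ (k mod N) ≡ k % N
  toℕ-mod k = toℕ-fromℕ< (m%n<n k N)

  toℕ-⊕ : ∀ (i j : Fin N) → toℕ (i ⊕ j) ≡ (toℕ i + toℕ j) % N
  toℕ-⊕ i j = toℕ-mod (toℕ i + toℕ j)

  toℕ-· : ∀ k (x : Fin N) → toℕ (k · x) ≡ (k * toℕ x) % N
  toℕ-· k x = toℕ-mod (k * toℕ x)

  toℕ-%-fixed : ∀ (i : Fin N) → toℕ i % N ≡ toℕ i
  toℕ-%-fixed i = m<n⇒m%n≡m (toℕ<n i)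

  [m%n+o]%n≡[m+o]%n : ∀ k l → (k % N + l) % N ≡ (k + l) % N
  [m%n+o]%n≡[m+o]%n k l = begin
    (k % N + l) % N          ≡⟨ %-distribˡ-+ (k % N) l N ⟩
    (k % N % N + l % N) % N  ≡⟨ cong (λ v → (v + l % N) % N) (m%n%n≡m%n k N) ⟩
    (k % N + l % N) % N      ≡⟨ %-distribˡ-+ k l N ⟨
    (k + l) % N              ∎

  [m+o%n]%n≡[m+o]%n : ∀ k l → (k + l % N) % N ≡ (k + l) % N
  [m+o%n]%n≡[m+o]%n k l = begin
    (k + l % N) % N  ≡⟨ cong (_% N) (+-comm k (l % N)) ⟩
    (l % N + k) % N  ≡⟨ [m%n+o]%n≡[m+o]%n l k ⟩
    (l + k) % N      ≡⟨ cong (_% N) (+-comm l k) ⟩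
    (k + l) % N      ∎

  ⊕-comm : ∀ (i j : Fin N) → i ⊕ j ≡ j ⊕ i
  ⊕-comm i j = cong (_mod N) (+-comm (toℕ i) (toℕ j))

  ⊕-assoc : ∀ (i j k : Fin N) → (i ⊕ j) ⊕ k ≡ i ⊕ (j ⊕ k)
  ⊕-assoc i j k = toℕ-injective (begin
    toℕ ((i ⊕ j) ⊕ k)                       ≡⟨ toℕ-⊕ (i ⊕ j) k ⟩
    (toℕ (i ⊕ j) + toℕ k) % N               ≡⟨ cong (λ v → (v + toℕ k) % N) (toℕ-⊕ i j) ⟩
    ((toℕ i + toℕ j) % N + toℕ k) % N       ≡⟨ [m%n+o]%n≡[m+o]%n (toℕ i + toℕ j) (toℕ k) ⟩
    (toℕ i + toℕ j + toℕ k) % N             ≡⟨ cong (_% N) (+-assoc (toℕ i) (toℕ j) (toℕ k)) ⟩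
    (toℕ i + (toℕ j + toℕ k)) % N           ≡⟨ [m+o%n]%n≡[m+o]%n (toℕ i) (toℕ j + toℕ k) ⟨
    (toℕ i + (toℕ j + toℕ k) % N) % N       ≡⟨ cong (λ v → (toℕ i + v) % N) (toℕ-⊕ j k) ⟨
    (toℕ i + toℕ (j ⊕ k)) % N               ≡⟨ toℕ-⊕ i (j ⊕ k) ⟨
    toℕ (i ⊕ (j ⊕ k))                       ∎)

  ⊕-identityˡ : ∀ (i : Fin N) → 0F ⊕ i ≡ i
  ⊕-identityˡ i = toℕ-injective (trans (toℕ-⊕ 0F i) (toℕ-%-fixed i))

  ⊕-identityʳ : ∀ (i : Fin N) → i ⊕ 0F ≡ i
  ⊕-identityʳ i = trans (⊕-comm i 0F) (⊕-identityˡ i)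

  ⊖-inverseʳ : ∀ (i : Fin N) → i ⊖ i ≡ 0F
  ⊖-inverseʳ i = toℕ-injective (begin
    toℕ (i ⊖ i)                    ≡⟨ toℕ-⊕ i (⊖ i) ⟩
    (toℕ i + toℕ (⊖ i)) % N        ≡⟨ cong (λ v → (toℕ i + v) % N) (toℕ-mod (N ∸ toℕ i)) ⟩
    (toℕ i + (N ∸ toℕ i) % N) % N  ≡⟨ [m+o%n]%n≡[m+o]%n (toℕ i) (N ∸ toℕ i) ⟩
    (toℕ i + (N ∸ toℕ i)) % N      ≡⟨ cong (_% N) (m+[n∸m]≡n (toℕ≤n i)) ⟩
    N % N                          ≡⟨ n%n≡0 N ⟩
    0                              ∎)

  ⊖-inverseˡ : ∀ (i : Fin N) → (⊖ i) ⊕ i ≡ 0F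
  ⊖-inverseˡ i = trans (⊕-comm (⊖ i) i) (⊖-inverseʳ i)

  ⊕-⊖-isAbelianGroup : IsAbelianGroup _≡_ _⊕_ 0F (λ i → ⊖ i)
  ⊕-⊖-isAbelianGroup = record
    { isGroup = record
      { isMonoid = record
        { isSemigroup = record
          { isMagma = record { isEquivalence = isEquivalence ; ∙-cong = cong₂ _⊕_ }
          ; assoc = ⊕-assoc }
        ; identity = ⊕-identityˡ , ⊕-identityʳ }
      ; inverse = ⊖-inverseˡ , ⊖-inverseʳ
      ; ⁻¹-cong = cong (λ i → ⊖ i) }
    ; comm = ⊕-comm }

  ⊕-⊖-abelianGroup : AbelianGroup 0ℓ 0ℓ
  ⊕-⊖-abelianGroup = record { isAbelianGroup = ⊕-⊖-isAbelianGroup }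

  ·-distribʳ-+ : ∀ k l (x : Fin N) → (k + l) · x ≡ k · x ⊕ l · x
  ·-distribʳ-+ k l x = toℕ-injective (begin
    toℕ ((k + l) · x)                        ≡⟨ toℕ-· (k + l) x ⟩
    ((k + l) * toℕ x) % N                    ≡⟨ cong (_% N) (*-distribʳ-+ (toℕ x) k l) ⟩
    (k * toℕ x + l * toℕ x) % N              ≡⟨ %-distribˡ-+ (k * toℕ x) (l * toℕ x) N ⟩
    ((k * toℕ x) % N + (l * toℕ x) % N) % N  ≡⟨ cong₂ (λ u v → (u + v) % N) (toℕ-· k x) (toℕ-· l x) ⟨
    (toℕ (k · x) + toℕ (l · x)) % N          ≡⟨ toℕ-⊕ (k · x) (l · x) ⟨
    toℕ (k · x ⊕ l · x)                      ∎)

  1·x≡x : ∀ (x : Fin N) → 1 · x ≡ x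
  1·x≡x x = toℕ-injective (begin
    toℕ (1 · x)          ≡⟨ toℕ-· 1 x ⟩
    (toℕ x + 0) % N      ≡⟨ cong (_% N) (+-identityʳ (toℕ x)) ⟩
    toℕ x % N            ≡⟨ toℕ-%-fixed x ⟩
    toℕ x                ∎)

  open import Algebra.Properties.AbelianGroup ⊕-⊖-abelianGroup
    using (x≈z//y; //-rightDividesˡ; ⁻¹-involutive; ⁻¹-∙-comm)

  ⊖-involutive : ∀ (x : Fin N) → ⊖ ⊖ x ≡ x
  ⊖-involutive = ⁻¹-involutive

  ⊖⊕-cancel : ∀ (x t : Fin N) → x ≡ (x ⊖ t) ⊕ t
  ⊖⊕-cancel x t = sym (//-rightDividesˡ t x)

  ⊕-≡-⊖ : ∀ (x t : Fin N) {y} → y ≡ x ⊕ t → x ≡ y ⊖ t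
  ⊕-≡-⊖ x t {y} y≡x⊕t = x≈z//y x t y (sym y≡x⊕t)

  ⊖-swap : ∀ (x t : Fin N) {y} → y ≡ x ⊕ t → ⊖ x ≡ ⊖ y ⊕ t
  ⊖-swap x t refl = begin
    ⊖ x                  ≡⟨ ⊖⊕-cancel (⊖ x) t ⟩
    ⊖ x ⊖ t ⊕ t          ≡⟨ cong (_⊕ t) (⁻¹-∙-comm x t) ⟩
    ⊖ (x ⊕ t) ⊕ t        ∎

A-≢ : ∀ {n} {i j : Fin n} → i ≢ j → A i ≢ A j
A-≢ i≢j refl = i≢j refl

B-≢ : ∀ {n} {i j : Fin n} → i ≢ j → B i ≢ B j
B-≢ i≢j refl = i≢j refl

C-≢ : ∀ {n} {i j : Fin n} → i ≢ j → C i ≢ C j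
C-≢ i≢j refl = i≢j refl

middle-≢ : ∀ {X Y Z : Set} {x x′ : X} {y y′ : Y} {z z′ : Z} → y ≢ y′ → (x , y , z) ≢ (x′ , y′ , z′)
middle-≢ y≢y′ refl = y≢y′ refl

module Basic6-Properties {n : ℕ} (a b c d : Fin n) where
  open WH a b c d

  BasicColouring : V n → V n → V n → V n → V n → V n → Set
  BasicColouring v₀ v₁ v₂ v₃ v₄ v₅ =
      (Blue v₀ v₁ × Red v₁ v₂ × Red v₂ v₃ × Blue v₃ v₄ × Red v₄ v₅ × Red v₅ v₀)
    ⊎ (Red v₀ v₁ × Blue v₁ v₂ × Red v₂ v₃ × Red v₃ v₄ × Blue v₄ v₅ × Red v₅ v₀)
    ⊎ (Red v₀ v₁ × Red v₁ v₂ × Blue v₂ v₃ × Red v₃ v₄ × Red v₄ v₅ × Blue v₅ v₀)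

  Basic6-reverse : ∀ {v₀ v₁ v₂ v₃ v₄ v₅} → Basic6 v₀ v₁ v₂ v₃ v₄ v₅ → Basic6 v₂ v₁ v₀ v₅ v₄ v₃
  Basic6-reverse {v₀} {v₁} {v₂} {v₃} {v₄} {v₅}
    ((≢₀₁ , ≢₀₂ , ≢₀₃ , ≢₀₄ , ≢₀₅ , ≢₁₂ , ≢₁₃ , ≢₁₄ , ≢₁₅ , ≢₂₃ , ≢₂₄ , ≢₂₅ , ≢₃₄ , ≢₃₅ , ≢₄₅) , colours) =
    (≢-sym ≢₁₂ , ≢-sym ≢₀₂ , ≢₂₅ , ≢₂₄ , ≢₂₃ , ≢-sym ≢₀₁ , ≢₁₅ , ≢₁₄ , ≢₁₃ , ≢₀₅ , ≢₀₄ , ≢₀₃ ,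
     ≢-sym ≢₄₅ , ≢-sym ≢₃₅ , ≢-sym ≢₃₄) ,
    reverse-colours colours
    where
    reverse-colours : BasicColouring v₀ v₁ v₂ v₃ v₄ v₅ → BasicColouring v₂ v₁ v₀ v₅ v₄ v₃
    reverse-colours (inj₁ (e₀₁ , e₁₂ , e₂₃ , e₃₄ , e₄₅ , e₅₀)) =
      inj₂ (inj₁ (swap e₁₂ , swap e₀₁ , swap e₅₀ , swap e₄₅ , swap e₃₄ , swap e₂₃))
    reverse-colours (inj₂ (inj₁ (e₀₁ , e₁₂ , e₂₃ , e₃₄ , e₄₅ , e₅₀))) =
      inj₁ (swap e₁₂ , swap e₀₁ , swap e₅₀ , swap e₄₅ , swap e₃₄ , swap e₂₃)
    reverse-colours (inj₂ (inj₂ (e₀₁ , e₁₂ , e₂₃ , e₃₄ , e₄₅ , e₅₀))) =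
      inj₂ (inj₂ (swap e₁₂ , swap e₀₁ , swap e₅₀ , swap e₄₅ , swap e₃₄ , swap e₂₃))

  Basic6-map : (f : V n → V n) → (∀ {u v} → f u ≡ f v → u ≡ v) →
    (∀ {u v} → Blue u v → Blue (f u) (f v)) → (∀ {u v} → Red u v → Red (f u) (f v)) →
    ∀ {v₀ v₁ v₂ v₃ v₄ v₅} → Basic6 v₀ v₁ v₂ v₃ v₄ v₅ → Basic6 (f v₀) (f v₁) (f v₂) (f v₃) (f v₄) (f v₅)
  Basic6-map f f-injective blue red {v₀} {v₁} {v₂} {v₃} {v₄} {v₅}
    ((≢₀₁ , ≢₀₂ , ≢₀₃ , ≢₀₄ , ≢₀₅ , ≢₁₂ , ≢₁₃ , ≢₁₄ , ≢₁₅ , ≢₂₃ , ≢₂₄ , ≢₂₅ , ≢₃₄ , ≢₃₅ , ≢₄₅) , colours) =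
    (≢₀₁ ∘ f-injective , ≢₀₂ ∘ f-injective , ≢₀₃ ∘ f-injective , ≢₀₄ ∘ f-injective , ≢₀₅ ∘ f-injective ,
     ≢₁₂ ∘ f-injective , ≢₁₃ ∘ f-injective , ≢₁₄ ∘ f-injective , ≢₁₅ ∘ f-injective ,
     ≢₂₃ ∘ f-injective , ≢₂₄ ∘ f-injective , ≢₂₅ ∘ f-injective ,
     ≢₃₄ ∘ f-injective , ≢₃₅ ∘ f-injective , ≢₄₅ ∘ f-injective) ,
    map-colours colours
    where
    map-colours : BasicColouring v₀ v₁ v₂ v₃ v₄ v₅ →
                  BasicColouring (f v₀) (f v₁) (f v₂) (f v₃) (f v₄) (f v₅)
    map-colours (inj₁ (e₀₁ , e₁₂ , e₂₃ , e₃₄ , e₄₅ , e₅₀)) =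
      inj₁ (blue e₀₁ , red e₁₂ , red e₂₃ , blue e₃₄ , red e₄₅ , red e₅₀)
    map-colours (inj₂ (inj₁ (e₀₁ , e₁₂ , e₂₃ , e₃₄ , e₄₅ , e₅₀))) =
      inj₂ (inj₁ (red e₀₁ , blue e₁₂ , red e₂₃ , red e₃₄ , blue e₄₅ , red e₅₀))
    map-colours (inj₂ (inj₂ (e₀₁ , e₁₂ , e₂₃ , e₃₄ , e₄₅ , e₅₀))) =
      inj₂ (inj₂ (red e₀₁ , red e₁₂ , blue e₂₃ , red e₃₄ , red e₄₅ , blue e₅₀))

module Symmetries {m : ℕ} (a b c d : Fin (suc m)) where
  open CyclicGroup m
  open WH a b c d
  open Basic6-Properties a b c d

  mirror : V (suc m) → V (suc m)
  mirror (A i) = A (⊖ i)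
  mirror (B i) = C (⊖ i)
  mirror (C i) = B (⊖ i)

  mirror-involutive : ∀ v → mirror (mirror v) ≡ v
  mirror-involutive (A i) = cong A (⊖-involutive i)
  mirror-involutive (B i) = cong B (⊖-involutive i)
  mirror-involutive (C i) = cong C (⊖-involutive i)

  mirror-injective : ∀ {u v} → mirror u ≡ mirror v → u ≡ v
  mirror-injective {u} {v} mu≡mv =
    trans (sym (mirror-involutive u)) (trans (cong mirror mu≡mv) (mirror-involutive v))

  mirror-BlueArc : ∀ {u v} → BlueArc u v → Blue (mirror u) (mirror v)
  mirror-BlueArc (ab i)       = inj₁ (ac (⊖ i))
  mirror-BlueArc (ac i)       = inj₁ (ab (⊖ i))
  mirror-BlueArc (bc i j j≡i⊕c) = inj₂ (bc (⊖ j) (⊖ i) (⊖-swap i c j≡i⊕c))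

  mirror-RedArc : ∀ {u v} → RedArc u v → Red (mirror u) (mirror v)
  mirror-RedArc (aa i j j≡i⊕a)  = inj₂ (aa (⊖ j) (⊖ i) (⊖-swap i a j≡i⊕a))
  mirror-RedArc (bcb i j j≡i⊕b) = inj₂ (bcb (⊖ j) (⊖ i) (⊖-swap i b j≡i⊕b))
  mirror-RedArc (bcd i j j≡i⊕d) = inj₂ (bcd (⊖ j) (⊖ i) (⊖-swap i d j≡i⊕d))

  mirror-Blue : ∀ {u v} → Blue u v → Blue (mirror u) (mirror v)
  mirror-Blue (inj₁ arc) = mirror-BlueArc arc
  mirror-Blue (inj₂ arc) = swap (mirror-BlueArc arc)

  mirror-Red : ∀ {u v} → Red u v → Red (mirror u) (mirror v)
  mirror-Red (inj₁ arc) = mirror-RedArc arc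
  mirror-Red (inj₂ arc) = swap (mirror-RedArc arc)

  TwoOrFour : V (suc m) → V (suc m) → V (suc m) → Set
  TwoOrFour u v w =
    (4 · a ≢ 0F → HasExactly 2 (Basic6Through u v w)) ×
    (4 · a ≡ 0F → HasExactly 4 (Basic6Through u v w))

  Triple : Set
  Triple = V (suc m) × V (suc m) × V (suc m)

  TwoOrFour-transfer : ∀ {u v w u′ v′ w′} (f g : Triple → Triple) →
    (∀ t → g (f t) ≡ t) → (∀ t → f (g t) ≡ t) →
    (∀ t → Basic6Through u v w t → Basic6Through u′ v′ w′ (f t)) →
    (∀ t → Basic6Through u′ v′ w′ t → Basic6Through u v w (g t)) →
    TwoOrFour u v w → TwoOrFour u′ v′ w′
  TwoOrFour-transfer f g g∘f f∘g forth back (two , four) =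
    (λ 4a≢0 → HasExactly-bijection f g g∘f f∘g (forth _) (back _) (two 4a≢0)) ,
    (λ 4a≡0 → HasExactly-bijection f g g∘f f∘g (forth _) (back _) (four 4a≡0))

  reverse³ : Triple → Triple
  reverse³ (x , y , z) = z , y , x

  reverse³-involutive : ∀ t → reverse³ (reverse³ t) ≡ t
  reverse³-involutive (x , y , z) = refl

  Basic6Through-reverse : ∀ {u v w} t → Basic6Through u v w t → Basic6Through w v u (reverse³ t)
  Basic6Through-reverse (x , y , z) = Basic6-reverse

  TwoOrFour-reverse : ∀ {u v w} → TwoOrFour u v w → TwoOrFour w v u
  TwoOrFour-reverse = TwoOrFour-transfer reverse³ reverse³ reverse³-involutive reverse³-involutive
    Basic6Through-reverse Basic6Through-reverse

  mirror³ : Triple → Triple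
  mirror³ (x , y , z) = mirror x , mirror y , mirror z

  mirror³-involutive : ∀ t → mirror³ (mirror³ t) ≡ t
  mirror³-involutive (x , y , z) =
    cong₂ _,_ (mirror-involutive x) (cong₂ _,_ (mirror-involutive y) (mirror-involutive z))

  Basic6-mirror : ∀ {v₀ v₁ v₂ v₃ v₄ v₅} → Basic6 v₀ v₁ v₂ v₃ v₄ v₅ →
    Basic6 (mirror v₀) (mirror v₁) (mirror v₂) (mirror v₃) (mirror v₄) (mirror v₅)
  Basic6-mirror = Basic6-map mirror mirror-injective mirror-Blue mirror-Red

  Basic6Through-mirror : ∀ {u v w} t → Basic6Through u v w t →
    Basic6Through (mirror u) (mirror v) (mirror w) (mirror³ t)
  Basic6Through-mirror (x , y , z) = Basic6-mirror

  Basic6Through-unmirror : ∀ {u v w} t → Basic6Through (mirror u) (mirror v) (mirror w) t →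
    Basic6Through u v w (mirror³ t)
  Basic6Through-unmirror {u} {v} {w} (x , y , z) through =
    subst-path (mirror-involutive u) (mirror-involutive v) (mirror-involutive w) (Basic6-mirror through)
    where
    subst-path : ∀ {u′ v′ w′ x y z} → u′ ≡ u → v′ ≡ v → w′ ≡ w →
      Basic6 u′ v′ w′ x y z → Basic6 u v w x y z
    subst-path refl refl refl basic = basic

  TwoOrFour-unmirror : ∀ {u v w} → TwoOrFour (mirror u) (mirror v) (mirror w) → TwoOrFour u v w
  TwoOrFour-unmirror = TwoOrFour-transfer mirror³ mirror³ mirror³-involutive mirror³-involutive
    Basic6Through-unmirror Basic6Through-mirror

module BasicSixCycles {m : ℕ} (a b c d : Fin (suc m))
  (d≡2a⊕b : d ≡ 2 · a ⊕ b) (2a≢0 : 2 · a ≢ 0F) (b≢c : b ≢ c) (c≢d : c ≢ d) where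

  open CyclicGroup m
  open WH a b c d
  open Symmetries a b c d
  open import Algebra.Properties.AbelianGroup ⊕-⊖-abelianGroup
    using (∙-cancelˡ; ∙-cancelʳ; identityʳ-unique)
  open import Algebra.Properties.CommutativeSemigroup
    (AbelianGroup.commutativeSemigroup ⊕-⊖-abelianGroup) using (xy∙z≈xz∙y)
  open ≡-Reasoning

  ℤₙ : Set
  ℤₙ = Fin (suc m)

  2a≡a⊕a : 2 · a ≡ a ⊕ a
  2a≡a⊕a = trans (·-distribʳ-+ 1 1 a) (cong₂ _⊕_ (1·x≡x a) (1·x≡x a))

  x⊕a≢x : ∀ x → x ⊕ a ≢ x
  x⊕a≢x x x⊕a≡x = 2a≢0 (begin
    2 · a   ≡⟨ 2a≡a⊕a ⟩
    a ⊕ a   ≡⟨ cong₂ _⊕_ a≡0 a≡0 ⟩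
    0F ⊕ 0F ≡⟨ ⊕-identityʳ 0F ⟩
    0F      ∎)
    where
    a≡0 : a ≡ 0F
    a≡0 = identityʳ-unique x a x⊕a≡x

  -- A record rather than the bare equation, so that both ends can be inferred:
  -- _⊕_ is computed through _mod_ and does not unify injectively.
  infix 4 _⟶_
  record _⟶_ (x y : ℤₙ) : Set where
    constructor step
    field ≡⊕2a : y ≡ x ⊕ 2 · a
  open _⟶_

  ⟶-two-a-steps : ∀ x → x ⟶ x ⊕ a ⊕ a
  ⟶-two-a-steps x = step (trans (⊕-assoc x a a) (cong (x ⊕_) (sym 2a≡a⊕a)))

  ⟶-⊕b⊕d : ∀ x → x ⊕ b ⟶ x ⊕ d
  ⟶-⊕b⊕d x = step (begin
    x ⊕ d            ≡⟨ cong (x ⊕_) d≡2a⊕b ⟩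
    x ⊕ (2 · a ⊕ b)  ≡⟨ cong (x ⊕_) (⊕-comm (2 · a) b) ⟩
    x ⊕ (b ⊕ 2 · a)  ≡⟨ ⊕-assoc x b (2 · a) ⟨
    x ⊕ b ⊕ 2 · a    ∎)

  ⟶-irreflexive : ∀ {x y} → x ⟶ y → x ≢ y
  ⟶-irreflexive {x} (step x≡x⊕2a) refl = 2a≢0 (identityʳ-unique x (2 · a) (sym x≡x⊕2a))

  ⟶-functional : ∀ {x y y′} → x ⟶ y → x ⟶ y′ → y ≡ y′
  ⟶-functional (step y≡x⊕2a) (step y′≡x⊕2a) = trans y≡x⊕2a (sym y′≡x⊕2a)

  ⟶-injective : ∀ {x x′ y} → x ⟶ y → x′ ⟶ y → x ≡ x′
  ⟶-injective {x} {x′} (step y≡x⊕2a) (step y≡x′⊕2a) = ∙-cancelʳ (2 · a) x x′ (trans (sym y≡x⊕2a) y≡x′⊕2a)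

  ⟶-⊕ : ∀ t {x y} → x ⟶ y → x ⊕ t ⟶ y ⊕ t
  ⟶-⊕ t {x} (step y≡x⊕2a) = step (trans (cong (_⊕ t) y≡x⊕2a) (xy∙z≈xz∙y x (2 · a) t))

  ⟶-⊕-cancel : ∀ t {x y} → x ⊕ t ⟶ y ⊕ t → x ⟶ y
  ⟶-⊕-cancel t {x} {y} (step y⊕t≡x⊕t⊕2a) =
    step (∙-cancelʳ t y (x ⊕ 2 · a) (trans y⊕t≡x⊕t⊕2a (sym (xy∙z≈xz∙y x (2 · a) t))))

  ⟶-cycle : ∀ {x y} → x ⟶ y → y ⟶ x → 4 · a ≡ 0F
  ⟶-cycle {x} {y} (step y≡x⊕2a) (step x≡y⊕2a) =
    trans (·-distribʳ-+ 2 2 a) (identityʳ-unique x (2 · a ⊕ 2 · a) (sym (begin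
      x                        ≡⟨ x≡y⊕2a ⟩
      y ⊕ 2 · a                ≡⟨ cong (_⊕ 2 · a) y≡x⊕2a ⟩
      x ⊕ 2 · a ⊕ 2 · a        ≡⟨ ⊕-assoc x (2 · a) (2 · a) ⟩
      x ⊕ (2 · a ⊕ 2 · a)      ∎)))

  ⟶-sym : 4 · a ≡ 0F → ∀ {x y} → x ⟶ y → y ⟶ x
  ⟶-sym 4a≡0 {x} {y} (step y≡x⊕2a) = step (sym (begin
    y ⊕ 2 · a                ≡⟨ cong (_⊕ 2 · a) y≡x⊕2a ⟩
    x ⊕ 2 · a ⊕ 2 · a        ≡⟨ ⊕-assoc x (2 · a) (2 · a) ⟩
    x ⊕ (2 · a ⊕ 2 · a)      ≡⟨ cong (x ⊕_) (·-distribʳ-+ 2 2 a) ⟨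
    x ⊕ 4 · a                ≡⟨ cong (x ⊕_) 4a≡0 ⟩
    x ⊕ 0F                   ≡⟨ ⊕-identityʳ x ⟩
    x                        ∎))

  ⟶⇒⊕b≡⊕d : ∀ {x y} → x ⟶ y → y ⊕ b ≡ x ⊕ d
  ⟶⇒⊕b≡⊕d {x} x⟶y = ⟶-functional (⟶-⊕ b x⟶y) (⟶-⊕b⊕d x)

  ⊕d≡⊕b⇒⟶ : ∀ {x y} → x ⊕ d ≡ y ⊕ b → x ⟶ y
  ⊕d≡⊕b⇒⟶ {x} x⊕d≡y⊕b = ⟶-⊕-cancel b (step (trans (sym x⊕d≡y⊕b) (≡⊕2a (⟶-⊕b⊕d x))))

  ⟶-via : ∀ s {x y} → x ≡ s ⊕ b → y ≡ s ⊕ d → x ⟶ y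
  ⟶-via s refl y≡s⊕d = step (trans y≡s⊕d (≡⊕2a (⟶-⊕b⊕d s)))

  ⊕b≢⊕d : ∀ x → x ⊕ b ≢ x ⊕ d
  ⊕b≢⊕d x = ⟶-irreflexive (⟶-⊕b⊕d x)

  ⊖d≢⊖b : ∀ x → x ⊖ d ≢ x ⊖ b
  ⊖d≢⊖b x x⊖d≡x⊖b =
    ⟶-irreflexive (⟶-via (x ⊖ d) (trans (⊖⊕-cancel x b) (cong (_⊕ b) (sym x⊖d≡x⊖b))) (⊖⊕-cancel x d)) refl

  red-not-blue : ∀ {s t} → RedArc (B s) (C t) → ¬ BlueArc (B s) (C t)
  red-not-blue {s} (bcb _ _ t≡s⊕b) (bc _ _ t≡s⊕c) = b≢c (∙-cancelˡ s b c (trans (sym t≡s⊕b) t≡s⊕c))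
  red-not-blue {s} (bcd _ _ t≡s⊕d) (bc _ _ t≡s⊕c) = c≢d (∙-cancelˡ s c d (trans (sym t≡s⊕c) t≡s⊕d))

  red-A-≢ : ∀ {i j} → Red (A i) (A j) → A i ≢ A j
  red-A-≢ (inj₁ (aa i _ j≡i⊕a)) refl = x⊕a≢x i (sym j≡i⊕a)
  red-A-≢ (inj₂ (aa j _ i≡j⊕a)) refl = x⊕a≢x j (sym i≡j⊕a)

  module Path-AAA (p : ℤₙ) where
    q r : ℤₙ
    q = p ⊕ a
    r = q ⊕ a

    p⟶r : p ⟶ r
    p⟶r = ⟶-two-a-steps p

    red-pq : Red (A p) (A q)
    red-pq = inj₁ (aa p q refl)

    red-qr : Red (A q) (A r)
    red-qr = inj₁ (aa q r refl)

    Ap≢Ar : A p ≢ A r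
    Ap≢Ar = A-≢ (⟶-irreflexive p⟶r)

    Br≢Bp : B r ≢ B p
    Br≢Bp = B-≢ (λ r≡p → ⟶-irreflexive p⟶r (sym r≡p))

    Cr≢Cp : C r ≢ C p
    Cr≢Cp = C-≢ (λ r≡p → ⟶-irreflexive p⟶r (sym r≡p))

    via-B : ∀ {j} → Red (B r) (C j) → Red (C j) (B p) → Basic6Through (A p) (A q) (A r) (B r , C j , B p)
    via-B red₁ red₂ =
      (red-A-≢ red-pq , Ap≢Ar , (λ ()) , (λ ()) , (λ ()) , red-A-≢ red-qr , (λ ()) , (λ ()) , (λ ()) ,
       (λ ()) , (λ ()) , (λ ()) , (λ ()) , Br≢Bp , (λ ())) ,
      inj₂ (inj₂ (red-pq , red-qr , inj₁ (ab r) , red₁ , red₂ , inj₂ (ab p)))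

    via-C : ∀ {j} → Red (C r) (B j) → Red (B j) (C p) → Basic6Through (A p) (A q) (A r) (C r , B j , C p)
    via-C red₁ red₂ =
      (red-A-≢ red-pq , Ap≢Ar , (λ ()) , (λ ()) , (λ ()) , red-A-≢ red-qr , (λ ()) , (λ ()) , (λ ()) ,
       (λ ()) , (λ ()) , (λ ()) , (λ ()) , Cr≢Cp , (λ ())) ,
      inj₂ (inj₂ (red-pq , red-qr , inj₁ (ac r) , red₁ , red₂ , inj₂ (ac p)))

    cycle₁ cycle₂ cycle₃ cycle₄ : V (suc m) × V (suc m) × V (suc m)
    cycle₁ = B r , C (r ⊕ b) , B p
    cycle₂ = C r , B (r ⊖ d) , C p
    cycle₃ = B r , C (r ⊕ d) , B p
    cycle₄ = C r , B (r ⊖ b) , C p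

    basic₁ : Basic6Through (A p) (A q) (A r) cycle₁
    basic₁ = via-B (inj₁ (bcb r _ refl)) (inj₂ (bcd p _ (⟶⇒⊕b≡⊕d p⟶r)))

    basic₂ : Basic6Through (A p) (A q) (A r) cycle₂
    basic₂ = via-C (inj₂ (bcd s r (⊖⊕-cancel r d)))
      (inj₁ (bcb s p (⟶-injective p⟶r (⟶-via s refl (⊖⊕-cancel r d)))))
      where s = r ⊖ d

    basic₃ : 4 · a ≡ 0F → Basic6Through (A p) (A q) (A r) cycle₃
    basic₃ 4a≡0 = via-B (inj₁ (bcd r _ refl)) (inj₂ (bcb p _ (sym (⟶⇒⊕b≡⊕d (⟶-sym 4a≡0 p⟶r)))))

    basic₄ : 4 · a ≡ 0F → Basic6Through (A p) (A q) (A r) cycle₄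
    basic₄ 4a≡0 = via-C (inj₂ (bcb s r (⊖⊕-cancel r b)))
      (inj₁ (bcd s p (⟶-functional (⟶-sym 4a≡0 p⟶r) (⟶-via s (⊖⊕-cancel r b) refl))))
      where s = r ⊖ b

    classify-closing : ∀ {x y z} → Blue (A r) x → Red x y → Red y z → Blue z (A p) →
      AmongTwoOrFour (4 · a ≡ 0F) cycle₁ cycle₂ cycle₃ cycle₄ (x , y , z)
    classify-closing (inj₁ (ab _)) (inj₁ (bcb _ j j≡r⊕b)) (inj₂ (bcb _ _ j≡p⊕b)) (inj₂ (ab _)) =
      ⊥-elim (Br≢Bp (cong B (∙-cancelʳ b r p (trans (sym j≡r⊕b) j≡p⊕b))))
    classify-closing (inj₁ (ab _)) (inj₁ (bcb _ j j≡r⊕b)) (inj₂ (bcd _ _ _)) (inj₂ (ab _)) =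
      inj₁ (cong (λ j → B r , C j , B p) j≡r⊕b)
    classify-closing (inj₁ (ab _)) (inj₁ (bcd _ j j≡r⊕d)) (inj₂ (bcb _ _ j≡p⊕b)) (inj₂ (ab _)) =
      inj₂ (inj₂ (⟶-cycle p⟶r (⊕d≡⊕b⇒⟶ (trans (sym j≡r⊕d) j≡p⊕b)) ,
                  inj₁ (cong (λ j → B r , C j , B p) j≡r⊕d)))
    classify-closing (inj₁ (ab _)) (inj₁ (bcd _ j j≡r⊕d)) (inj₂ (bcd _ _ j≡p⊕d)) (inj₂ (ab _)) =
      ⊥-elim (Br≢Bp (cong B (∙-cancelʳ d r p (trans (sym j≡r⊕d) j≡p⊕d))))
    classify-closing (inj₁ (ac _)) (inj₂ (bcb j _ r≡j⊕b)) (inj₁ (bcb _ _ p≡j⊕b)) (inj₂ (ac _)) =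
      ⊥-elim (Cr≢Cp (cong C (trans r≡j⊕b (sym p≡j⊕b))))
    classify-closing (inj₁ (ac _)) (inj₂ (bcb j _ r≡j⊕b)) (inj₁ (bcd _ _ p≡j⊕d)) (inj₂ (ac _)) =
      inj₂ (inj₂ (⟶-cycle p⟶r (⟶-via j r≡j⊕b p≡j⊕d) ,
                  inj₂ (cong (λ j → C r , B j , C p) (⊕-≡-⊖ j b r≡j⊕b))))
    classify-closing (inj₁ (ac _)) (inj₂ (bcd j _ r≡j⊕d)) (inj₁ (bcb _ _ _)) (inj₂ (ac _)) =
      inj₂ (inj₁ (cong (λ j → C r , B j , C p) (⊕-≡-⊖ j d r≡j⊕d)))
    classify-closing (inj₁ (ac _)) (inj₂ (bcd j _ r≡j⊕d)) (inj₁ (bcd _ _ p≡j⊕d)) (inj₂ (ac _)) =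
      ⊥-elim (Cr≢Cp (cong C (trans r≡j⊕d (sym p≡j⊕d))))

    classify : ∀ t → Basic6Through (A p) (A q) (A r) t →
      AmongTwoOrFour (4 · a ≡ 0F) cycle₁ cycle₂ cycle₃ cycle₄ t
    classify _ (_ , inj₁ (inj₁ () , _))
    classify _ (_ , inj₁ (inj₂ () , _))
    classify _ (_ , inj₂ (inj₁ (_ , inj₁ () , _)))
    classify _ (_ , inj₂ (inj₁ (_ , inj₂ () , _)))
    classify _ (_ , inj₂ (inj₂ (_ , _ , wx , xy , yz , zu))) = classify-closing wx xy yz zu

    two-or-four : TwoOrFour (A p) (A q) (A r)
    two-or-four = exactly-two-or-four cycle₁ cycle₂ cycle₃ cycle₄
      (((λ ()) ∷ ≢₁₃ ∷ (λ ()) ∷ []) ∷ ((λ ()) ∷ ≢₂₄ ∷ []) ∷ ((λ ()) ∷ []) ∷ [] ∷ [])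
      basic₁ basic₂ basic₃ basic₄ classify
      where
      ≢₁₃ : cycle₁ ≢ cycle₃
      ≢₁₃ = middle-≢ (C-≢ (⊕b≢⊕d r))
      ≢₂₄ : cycle₂ ≢ cycle₄
      ≢₂₄ = middle-≢ (B-≢ (⊖d≢⊖b r))

  module Path-CBC (q : ℤₙ) where
    p r : ℤₙ
    p = q ⊕ b
    r = q ⊕ d

    p⟶r : p ⟶ r
    p⟶r = ⟶-⊕b⊕d q

    red-pq : Red (C p) (B q)
    red-pq = inj₂ (bcb q p refl)

    red-qr : Red (B q) (C r)
    red-qr = inj₁ (bcd q r refl)

    Cp≢Cr : C p ≢ C r
    Cp≢Cr = C-≢ (⟶-irreflexive p⟶r)

    Ar≢Ap : A r ≢ A p
    Ar≢Ap = A-≢ (λ r≡p → ⟶-irreflexive p⟶r (sym r≡p))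

    blue-partners-differ : ∀ {s k} → r ≡ s ⊕ c → p ≡ k ⊕ c → s ≢ k
    blue-partners-differ r≡s⊕c p≡k⊕c refl = Cp≢Cr (cong C (trans p≡k⊕c (sym r≡s⊕c)))

    through-B-shape : ∀ {s j k} β → r ≡ s ⊕ c → j ≡ s ⊕ β → p ≡ k ⊕ c →
      (B s , C j , B k) ≡ (B (r ⊖ c) , C (r ⊖ c ⊕ β) , B (p ⊖ c))
    through-B-shape {s} {j} {k} β r≡s⊕c j≡s⊕β p≡k⊕c =
      cong₂ _,_ (cong B s≡r⊖c)
                (cong₂ _,_ (cong C (trans j≡s⊕β (cong (_⊕ β) s≡r⊖c))) (cong B (⊕-≡-⊖ k c p≡k⊕c)))
      where
      s≡r⊖c : s ≡ r ⊖ c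
      s≡r⊖c = ⊕-≡-⊖ s c r≡s⊕c

    via-A : ∀ {j} → Red (A r) (A j) → Red (A j) (A p) → Basic6Through (C p) (B q) (C r) (A r , A j , A p)
    via-A red₁ red₂ =
      ((λ ()) , Cp≢Cr , (λ ()) , (λ ()) , (λ ()) , (λ ()) , (λ ()) , (λ ()) , (λ ()) ,
       (λ ()) , (λ ()) , (λ ()) , red-A-≢ red₁ , Ar≢Ap , red-A-≢ red₂) ,
      inj₂ (inj₂ (red-pq , red-qr , inj₂ (ac r) , red₁ , red₂ , inj₁ (ac p)))

    via-B : ∀ {s j k} → BlueArc (B s) (C r) → RedArc (B s) (C j) → RedArc (B k) (C j) → BlueArc (B k) (C p) →
      Basic6Through (C p) (B q) (C r) (B s , C j , B k)
    via-B blue₁@(bc _ _ r≡s⊕c) red₁ red₂ blue₂@(bc _ _ p≡k⊕c) =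
      ((λ ()) , Cp≢Cr , (λ ()) , (λ { refl → red-not-blue red₂ blue₂ }) , (λ ()) ,
       (λ ()) , (λ { refl → red-not-blue (bcd q r refl) blue₁ }) , (λ ()) ,
       (λ { refl → red-not-blue (bcb q p refl) blue₂ }) ,
       (λ ()) , (λ { refl → red-not-blue red₁ blue₁ }) , (λ ()) ,
       (λ ()) , B-≢ (blue-partners-differ r≡s⊕c p≡k⊕c) , (λ ())) ,
      inj₂ (inj₂ (red-pq , red-qr , inj₂ blue₁ , inj₁ red₁ , inj₂ red₂ , inj₁ blue₂))

    cycle₁ cycle₂ cycle₃ cycle₄ : V (suc m) × V (suc m) × V (suc m)
    cycle₁ = A r , A (r ⊖ a) , A p
    cycle₂ = B (r ⊖ c) , C (r ⊖ c ⊕ b) , B (p ⊖ c)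
    cycle₃ = A r , A (r ⊕ a) , A p
    cycle₄ = B (r ⊖ c) , C (r ⊖ c ⊕ d) , B (p ⊖ c)

    basic₁ : Basic6Through (C p) (B q) (C r) cycle₁
    basic₁ = via-A (inj₂ (aa (r ⊖ a) r (⊖⊕-cancel r a)))
      (inj₂ (aa p (r ⊖ a) (sym (⊕-≡-⊖ (p ⊕ a) a (⟶-functional p⟶r (⟶-two-a-steps p))))))

    basic₂ : Basic6Through (C p) (B q) (C r) cycle₂
    basic₂ = via-B (bc (r ⊖ c) r (⊖⊕-cancel r c)) (bcb (r ⊖ c) _ refl)
      (bcd (p ⊖ c) _ (⟶⇒⊕b≡⊕d (⟶-⊕ (⊖ c) p⟶r))) (bc (p ⊖ c) p (⊖⊕-cancel p c))

    basic₃ : 4 · a ≡ 0F → Basic6Through (C p) (B q) (C r) cycle₃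
    basic₃ 4a≡0 = via-A (inj₁ (aa r _ refl))
      (inj₁ (aa (r ⊕ a) p (⟶-functional (⟶-sym 4a≡0 p⟶r) (⟶-two-a-steps r))))

    basic₄ : 4 · a ≡ 0F → Basic6Through (C p) (B q) (C r) cycle₄
    basic₄ 4a≡0 = via-B (bc (r ⊖ c) r (⊖⊕-cancel r c)) (bcd (r ⊖ c) _ refl)
      (bcb (p ⊖ c) _ (sym (⟶⇒⊕b≡⊕d (⟶-⊕ (⊖ c) (⟶-sym 4a≡0 p⟶r))))) (bc (p ⊖ c) p (⊖⊕-cancel p c))

    classify-closing : ∀ {x y z} → Blue (C r) x → Red x y → Red y z → Blue z (C p) →
      AmongTwoOrFour (4 · a ≡ 0F) cycle₁ cycle₂ cycle₃ cycle₄ (x , y , z)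
    classify-closing (inj₂ (ac _)) (inj₁ (aa _ t t≡r⊕a)) (inj₁ (aa _ _ p≡t⊕a)) (inj₁ (ac _)) =
      inj₂ (inj₂ (⟶-cycle p⟶r r⟶p , inj₁ (cong (λ t → A r , A t , A p) t≡r⊕a)))
      where
      r⟶p : r ⟶ p
      r⟶p = step (trans p≡t⊕a (trans (cong (_⊕ a) t≡r⊕a) (≡⊕2a (⟶-two-a-steps r))))
    classify-closing (inj₂ (ac _)) (inj₁ (aa _ t t≡r⊕a)) (inj₂ (aa _ _ t≡p⊕a)) (inj₁ (ac _)) =
      ⊥-elim (Ar≢Ap (cong A (∙-cancelʳ a r p (trans (sym t≡r⊕a) t≡p⊕a))))
    classify-closing (inj₂ (ac _)) (inj₂ (aa t _ r≡t⊕a)) (inj₁ (aa _ _ p≡t⊕a)) (inj₁ (ac _)) =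
      ⊥-elim (Ar≢Ap (cong A (trans r≡t⊕a (sym p≡t⊕a))))
    classify-closing (inj₂ (ac _)) (inj₂ (aa t _ r≡t⊕a)) (inj₂ (aa _ _ _)) (inj₁ (ac _)) =
      inj₁ (cong (λ t → A r , A t , A p) (⊕-≡-⊖ t a r≡t⊕a))
    classify-closing (inj₂ (bc s _ r≡s⊕c)) (inj₁ (bcb _ j j≡s⊕b)) (inj₂ (bcb k _ j≡k⊕b)) (inj₁ (bc _ _ p≡k⊕c)) =
      ⊥-elim (blue-partners-differ r≡s⊕c p≡k⊕c (∙-cancelʳ b s k (trans (sym j≡s⊕b) j≡k⊕b)))
    classify-closing (inj₂ (bc s _ r≡s⊕c)) (inj₁ (bcb _ j j≡s⊕b)) (inj₂ (bcd k _ _)) (inj₁ (bc _ _ p≡k⊕c)) =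
      inj₂ (inj₁ (through-B-shape b r≡s⊕c j≡s⊕b p≡k⊕c))
    classify-closing (inj₂ (bc s _ r≡s⊕c)) (inj₁ (bcd _ j j≡s⊕d)) (inj₂ (bcb k _ j≡k⊕b)) (inj₁ (bc _ _ p≡k⊕c)) =
      inj₂ (inj₂ (⟶-cycle k⟶s s⟶k , inj₂ (through-B-shape d r≡s⊕c j≡s⊕d p≡k⊕c)))
      where
      s⟶k : s ⟶ k
      s⟶k = ⊕d≡⊕b⇒⟶ (trans (sym j≡s⊕d) j≡k⊕b)
      k⟶s : k ⟶ s
      k⟶s = ⟶-⊕-cancel c (subst₂ _⟶_ p≡k⊕c r≡s⊕c p⟶r)
    classify-closing (inj₂ (bc s _ r≡s⊕c)) (inj₁ (bcd _ j j≡s⊕d)) (inj₂ (bcd k _ j≡k⊕d)) (inj₁ (bc _ _ p≡k⊕c)) =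
      ⊥-elim (blue-partners-differ r≡s⊕c p≡k⊕c (∙-cancelʳ d s k (trans (sym j≡s⊕d) j≡k⊕d)))

    classify : ∀ t → Basic6Through (C p) (B q) (C r) t →
      AmongTwoOrFour (4 · a ≡ 0F) cycle₁ cycle₂ cycle₃ cycle₄ t
    classify _ (_ , inj₁ (inj₂ blue , _)) = ⊥-elim (red-not-blue (bcb q p refl) blue)
    classify _ (_ , inj₂ (inj₁ (_ , inj₁ blue , _))) = ⊥-elim (red-not-blue (bcd q r refl) blue)
    classify _ (_ , inj₂ (inj₂ (_ , _ , wx , xy , yz , zu))) = classify-closing wx xy yz zu

    two-or-four : TwoOrFour (C p) (B q) (C r)
    two-or-four = exactly-two-or-four cycle₁ cycle₂ cycle₃ cycle₄
      (((λ ()) ∷ ≢₁₃ ∷ (λ ()) ∷ []) ∷ ((λ ()) ∷ ≢₂₄ ∷ []) ∷ ((λ ()) ∷ []) ∷ [] ∷ [])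
      basic₁ basic₂ basic₃ basic₄ classify
      where
      ≢₁₃ : cycle₁ ≢ cycle₃
      ≢₁₃ = middle-≢ (A-≢ (λ r⊖a≡r⊕a → ⟶-irreflexive (⟶-two-a-steps (r ⊖ a))
                          (trans r⊖a≡r⊕a (cong (_⊕ a) (⊖⊕-cancel r a)))))
      ≢₂₄ : cycle₂ ≢ cycle₄
      ≢₂₄ = middle-≢ (C-≢ (⊕b≢⊕d (r ⊖ c)))

  two-or-four-BCB : ∀ {p q r} → q ≡ p ⊕ b → q ≡ r ⊕ d → TwoOrFour (B p) (C q) (B r)
  two-or-four-BCB {p} {q} {r} q≡p⊕b q≡r⊕d =
    TwoOrFour-unmirror (subst₂ (λ p′ r′ → TwoOrFour (C p′) (B (⊖ q)) (C r′))
                          (sym (⊖-swap p b q≡p⊕b)) (sym (⊖-swap r d q≡r⊕d)) (Path-CBC.two-or-four (⊖ q)))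

  two-or-four-through : ∀ u v w → Red2Path u v w → TwoOrFour u v w
  two-or-four-through _ _ _ (_ , _ , _ , inj₁ (aa p _ refl) , inj₁ (aa _ _ refl)) = Path-AAA.two-or-four p
  two-or-four-through _ _ _ (_ , _ , u≢w , inj₁ (aa p _ refl) , inj₂ (aa r _ p⊕a≡r⊕a)) =
    ⊥-elim (u≢w (cong A (∙-cancelʳ a p r p⊕a≡r⊕a)))
  two-or-four-through _ _ _ (_ , _ , u≢w , inj₂ (aa q p p≡q⊕a) , inj₁ (aa _ r r≡q⊕a)) =
    ⊥-elim (u≢w (cong A (trans p≡q⊕a (sym r≡q⊕a))))
  two-or-four-through _ _ _ (_ , _ , _ , inj₂ (aa _ _ refl) , inj₂ (aa r _ refl)) =
    TwoOrFour-reverse (Path-AAA.two-or-four r)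
  two-or-four-through _ _ _ (_ , _ , u≢w , inj₁ (bcb p q q≡p⊕b) , inj₂ (bcb r _ q≡r⊕b)) =
    ⊥-elim (u≢w (cong B (∙-cancelʳ b p r (trans (sym q≡p⊕b) q≡r⊕b))))
  two-or-four-through _ _ _ (_ , _ , _ , inj₁ (bcb p q q≡p⊕b) , inj₂ (bcd r _ q≡r⊕d)) =
    two-or-four-BCB q≡p⊕b q≡r⊕d
  two-or-four-through _ _ _ (_ , _ , _ , inj₁ (bcd p q q≡p⊕d) , inj₂ (bcb r _ q≡r⊕b)) =
    TwoOrFour-reverse (two-or-four-BCB q≡r⊕b q≡p⊕d)
  two-or-four-through _ _ _ (_ , _ , u≢w , inj₁ (bcd p q q≡p⊕d) , inj₂ (bcd r _ q≡r⊕d)) =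
    ⊥-elim (u≢w (cong B (∙-cancelʳ d p r (trans (sym q≡p⊕d) q≡r⊕d))))
  two-or-four-through _ _ _ (_ , _ , u≢w , inj₂ (bcb q p p≡q⊕b) , inj₁ (bcb _ r r≡q⊕b)) =
    ⊥-elim (u≢w (cong C (trans p≡q⊕b (sym r≡q⊕b))))
  two-or-four-through _ _ _ (_ , _ , _ , inj₂ (bcb q _ refl) , inj₁ (bcd _ _ refl)) = Path-CBC.two-or-four q
  two-or-four-through _ _ _ (_ , _ , _ , inj₂ (bcd q _ refl) , inj₁ (bcb _ _ refl)) =
    TwoOrFour-reverse (Path-CBC.two-or-four q)
  two-or-four-through _ _ _ (_ , _ , u≢w , inj₂ (bcd q p p≡q⊕d) , inj₁ (bcd _ r r≡q⊕d)) =
    ⊥-elim (u≢w (cong C (trans p≡q⊕d (sym r≡q⊕d))))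

lemma4p4 : (n : ℕ) (a b c d : Fin n) →
    WHParams n a b c d →
    WH.VertexTransitive a b c d →
    2 ∣ n →
    ¬ IsZero b → ¬ IsZero d →
    2 · a ≡ d ⊖ b →
    Σ ℕ (λ p → Σ ℕ (λ q → TwoPart (gcd (toℕ c) n) p × TwoPart (gcd (toℕ a) n) q × q < p)) →
    WH.EdgeOrbitsBlueRed a b c d →
    (¬ IsZero (4 · a) → ∀ u v w → WH.Red2Path a b c d u v w →
        HasExactly 2 (WH.Basic6Through a b c d u v w)) ×
    (IsZero (4 · a) → ∀ u v w → WH.Red2Path a b c d u v w →
        HasExactly 4 (WH.Basic6Through a b c d u v w))
lemma4p4 zero ()
lemma4p4 (suc m) a b c d (_ , 2a≢0 , b≢c , _ , c≢d , _) _ _ _ _ 2a≡d⊖b _ _ =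
  (λ 4a≢0 u v w path → proj₁ (two-or-four-through u v w path) (4a≢0 ∘ cong toℕ)) ,
  (λ 4a≡0 u v w path → proj₂ (two-or-four-through u v w path) (toℕ-injective 4a≡0))
  where
  open CyclicGroup m using (⊖⊕-cancel)
  d≡2a⊕b : d ≡ 2 · a ⊕ b
  d≡2a⊕b = trans (⊖⊕-cancel d b) (cong (_⊕ b) (sym 2a≡d⊖b))
  open BasicSixCycles a b c d d≡2a⊕b (2a≢0 ∘ cong toℕ) b≢c c≢d
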